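{- Let $H$ be a $k$-uniform hypergraph, $\alpha\in(0,1)$, and consider any computation of the algorithm described in the context, for any initial coloring $c_0$. At every step of any evaluation of the procedure build_component, the current set $C$ equals a union of sets $V(S)$ over some family of potential resample structures $S$ (so every vertex of $C$ lies in $V(S)$ for some potential resample structure $S$ with $V(S)\subseteq C$).
   Context: Fix $\alpha\in(0,1)$ and a $k$-uniform hypergraph $H$ with $m$ edges. Every vertex $v$ receives an independent uniformly random initial color $c_0(v)\in\{\text{red},\text{blue}\}$. For an edge $f$, $N(f)$ is the set of edges of $H$ other than $f$ that intersect $f$. A potential resample structure (structure) is a pair $S=(f,(h_1,\dots,h_w))$ with $f$ an edge, $w\ge 0$ and $h_1,\dots,h_w\in N(f)$, such that (1) $f\setminus(h_1\cup\dots\cup h_w)$ is monochromatic under $c_0$ and has at least $(1-\alpha)k$ vertices, and (2) for every $j\in\{1,\dots,w\}$, the set $h_j\setminus(h_1\cup\dots\cup h_{j-1})$ contains at least $(1-\alpha)k$ vertices of one color under $c_0$ (in particular $(f,\epsilon)$ with empty sequence is a structure when $f$ is monochromatic under $c_0$). $V(S)$ denotes the union of the edges of $S$. The algorithm keeps, between queries, a set of vertices marked colored, a current partial coloring, and the list of components (vertex sets) built so far. A structure is fresh if $V(S)$ is disjoint from all components built so far. An edge $f$ is a mono-tail of a vertex set $C$ if $f\setminus C$ is monochromatic under $c_0$ and has at least $(1-\alpha)k$ vertices. A structure $S$ is at distance 1 from $C$ if $V(S)\cap C=\emptyset$ but some edge of $H$ intersects both $C$ and $V(S)$. $V_1(C)$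 is the union of all edges intersecting $C$. Procedure query$(v)$: if $v$ is marked colored, return its current color; otherwise, if some fresh structure $S$ has $v\in V(S)$, let $C\leftarrow$ build_component$(S)$ (recorded as a new component), $\rho\leftarrow$ color_component$(C)$, set the current colors of $C$ according to $\rho$, assign initial colors $c_0$ to $V_1(C)\setminus C$, and mark $V_1(C)$ colored; otherwise assign $v$ its initial color and mark it colored; return the current color of $v$. Procedure build_component$(S)$: start with $C\leftarrow V(S)$ and repeat: if $|C|$ exceeds a prescribed threshold, fail (the whole computation fails); else if some edge $f$ is a mono-tail of $C$, set $C\leftarrow C\cup f$; else if some fresh structure $S'$ is at distance 1 from $C$, set $C\leftarrow C\cup V(S')$; else stop and return $C$. Procedure color_component$(C)$: form the hypergraph $H_C$ with vertex set $C$ and edge set $\{f\cap C: f\in E(H),\ |f\cap C|\ge\alpha k\}$, let $E_t=|E(H_C)|/\Delta$, and up to $2\log_2(m)$ times run the Moser–Tardos RESAMPLE procedure on $H_C$ (start from a fresh uniformly random coloring and repeatedly pick a monochromatic edge and recolor its vertices uniformly at random) for $2E_t$ steps, returning a proper coloring as soon as one is found; if none is found, fail. A computation is the sequence of calls to query caused by an arbitrary sequence of queried vertices. -}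

module Defs where

open import Data.Nat using (ℕ; _+_; _*_; _∸_; _≤_)
open import Data.Bool using (Bool; true; false; if_then_else_)
import Data.Bool.Properties as BoolP
open import Data.Fin using (Fin)
import Data.Fin.Properties as FinP
open import Data.Fin.Subset hiding (⊤)
open import Data.Fin.Subset.Properties using (_∈?_; nonempty?)
open import Data.List using (List; []; _∷_; map; filter; allFin)
open import Data.List.Relation.Unary.All using (All)
open import Data.Product using (Σ; ∃; _×_; _,_)
open import Data.Unit using (⊤)
open import Data.Vec using (tabulate)
open import Relation.Nullary using (¬_; does)
open import Relation.Binary.PropositionalEquality using (_≡_; _≢_)
open import Relation.Binary.Construct.Closure.ReflexiveTransitive using (Star)

-- Parameters:
--   n  : number of vertices (vertex set Fin n)
--   m  : number of edges (edges indexed by Fin m, E i the i-th edge)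
--   k  : uniformity
--   α = p / q  (0 < p < q)
--   T  : the prescribed size threshold of build_component
--   c0 : the initial colouring (true = red, false = blue)
module Alg (n m k p q T : ℕ) (E : Fin m → Subset n) (c0 : Fin n → Bool) where

  -- "x ≥ (1-α)k"  ⟺  x * q ≥ (q - p) * k
  BigTail : ℕ → Set
  BigTail x = (q ∸ p) * k ≤ x * q

  -- "x ≥ α k"  ⟺  x * q ≥ p * k
  AtLeastαk : ℕ → Set
  AtLeastαk x = p * k ≤ x * q

  Mono : (Fin n → Bool) → Subset n → Set
  Mono c X = ∀ u v → u ∈ X → v ∈ X → c u ≡ c v

  ofColor : Bool → Subset n
  ofColor b = tabulate (λ v → does (c0 v BoolP.≟ b))

  ⋃E : List (Fin m) → Subset n
  ⋃E hs = ⋃ (map E hs)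

  InN : Fin m → Fin m → Set
  InN f h = (h ≢ f) × Nonempty (E h ∩ E f)

  -- condition (2), U = union of the previous edges h_1 .. h_{j-1}
  Cond2 : Subset n → List (Fin m) → Set
  Cond2 U [] = ⊤
  Cond2 U (h ∷ hs) =
    (∃ λ b → BigTail ∣ ofColor b ∩ (E h ─ U) ∣) × Cond2 (U ∪ E h) hs

  IsStructure : Fin m → List (Fin m) → Set
  IsStructure f hs =
    All (InN f) hs
    × Mono c0 (E f ─ ⋃E hs) × BigTail ∣ E f ─ ⋃E hs ∣
    × Cond2 ⊥ hs

  record Struct : Set where
    constructor struct
    field
      top   : Fin m
      seq   : List (Fin m)
      isStr : IsStructure top seq

  V : Struct → Subset n
  V S = E (Struct.top S) ∪ ⋃E (Struct.seq S)

  Fresh : List (Subset n) → Struct → Set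
  Fresh comps S = All (λ D → Empty (V S ∩ D)) comps

  MonoTail : Subset n → Fin m → Set
  MonoTail C f = Mono c0 (E f ─ C) × BigTail ∣ E f ─ C ∣

  Dist1 : Subset n → Struct → Set
  Dist1 C S = Empty (V S ∩ C) × ∃ λ g → Nonempty (E g ∩ C) × Nonempty (E g ∩ V S)

  -- one (non-failing) iteration of the loop of build_component
  data BuildStep (comps : List (Subset n)) : Subset n → Subset n → Set where
    addTail : ∀ {C} → ∣ C ∣ ≤ T → (f : Fin m) → MonoTail C f →
              BuildStep comps C (C ∪ E f)
    addStruct : ∀ {C} → ∣ C ∣ ≤ T → (∀ f → ¬ MonoTail C f) →
                (S : Struct) → Fresh comps S → Dist1 C S →
                BuildStep comps C (C ∪ V S)

  BuildReach : List (Subset n) → Struct → Subset n → Set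
  BuildReach comps S C = Star (BuildStep comps) (V S) C

  -- build_component(S) returns C (without failing)
  Returns : List (Subset n) → Struct → Subset n → Set
  Returns comps S C =
    BuildReach comps S C × ∣ C ∣ ≤ T × (∀ f → ¬ MonoTail C f)
    × (∀ S' → Fresh comps S' → ¬ Dist1 C S')

  ProperOn : Subset n → (Fin n → Bool) → Set
  ProperOn C ρ = ∀ f → AtLeastαk ∣ E f ∩ C ∣ → ¬ Mono ρ (E f ∩ C)

  V1 : Subset n → Subset n
  V1 C = ⋃E (filter (λ i → nonempty? (E i ∩ C)) (allFin m))

  record State : Set where
    constructor state
    field
      comps   : List (Subset n)
      colored : Subset n
      cur     : Fin n → Bool

  open State public

  initial : State
  initial = state [] ⊥ (λ _ → false)

  -- query(v) transforms state st into st' (without failing)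
  data Query (v : Fin n) : State → State → Set where
    already : ∀ {st} → v ∈ colored st → Query v st st
    build : ∀ {st} → v ∉ colored st → (S : Struct) → Fresh (comps st) S →
            v ∈ V S → (C : Subset n) → Returns (comps st) S C →
            (ρ : Fin n → Bool) → ProperOn C ρ →
            Query v st
              (state (C ∷ comps st) (colored st ∪ V1 C)
                     (λ u → if does (u ∈? C) then ρ u
                            else if does (u ∈? V1 C) then c0 u
                            else cur st u))
    single : ∀ {st} → v ∉ colored st →
             (∀ S → Fresh (comps st) S → v ∉ V S) →
             Query v st
               (state (comps st) (colored st ∪ ⁅ v ⁆)
                      (λ u → if does (u FinP.≟ v) then c0 v else cur st u))

  AnyQuery : State → State → Set
  AnyQuery st st' = ∃ λ v → Query v st st'

  Reachable : State → Set
  Reachable st = Star AnyQuery initial st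

-- The invariant kept by build_component is that C is the union of a list of edges h₁ … h_r
-- in which every h_j has at least (1-α)k vertices of one colour outside h₁ ∪ … ∪ h_{j-1}
-- (a chain, i.e. condition (2) of a structure), and that every vertex of C lies in some
-- V(S) ⊆ C. Adding a structure S disjoint from C appends the edges of S, its top edge last.
-- Adding a mono-tail f of C appends f, and the vertices of f outside C are covered by the
-- structure (f, the neighbours of f in the list), whose top tail is f ∖ C: f itself is not
-- in the list (it leaves C), so the edges of the list meeting f are its neighbours.
module Submission where

open import Defs
open import Data.Nat using (ℕ; _<_)
open import Data.Nat.Properties using (≤-trans; *-monoˡ-≤)
open import Data.Bool using (Bool; true)
import Data.Bool.Properties as Bool
open import Data.Empty using (⊥-elim)
open import Data.Fin using (Fin)
import Data.Fin.Properties as Fin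
open import Data.Fin.Subset
  using (Subset; _∈_; _∉_; _⊆_; ∣_∣; ⊥; _∪_; _∩_; _─_; Empty; inside; outside)
open import Data.Fin.Subset.Properties
  using ( ∉⊥; x∈p∩q⁺; x∈p∩q⁻; x∈p∪q⁺; x∈p∪q⁻; q⊆p∪q; p⊆q⇒∣p∣≤∣q∣; ⊆-antisym
        ; nonempty?; _∈?_; ∪-assoc; ∪-comm; ∪-identityˡ; ∪-identityʳ )
open import Data.List using (List; []; _∷_; _++_; filter)
import Data.List.Membership.Propositional as List
open import Data.List.Membership.Propositional.Properties using (∈-filter⁺; ∈-filter⁻)
open import Data.List.Relation.Binary.Sublist.Propositional using (_∷ʳ_; ⊆-refl)
  renaming (_⊆_ to _⊑_; [] to []ˢ; _∷_ to _∷ˢ_)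
open import Data.List.Relation.Binary.Sublist.Propositional.Properties using (filter-⊆)
open import Data.List.Relation.Unary.All.Properties using (all-filter)
open import Data.List.Relation.Unary.Any using (here; there)
open import Data.Product using (∃; _×_; _,_; proj₁; proj₂)
open import Data.Sum using (inj₁; inj₂)
open import Data.Unit using (tt)
open import Data.Vec using (_∷_; here; there)
import Data.Vec.Properties as Vec
open import Function using (_∘_)
open import Relation.Nullary using (yes; no; ¬?)
open import Relation.Nullary.Decidable using (dec-true; _×-dec_)
open import Relation.Unary using (Decidable)
open import Relation.Binary.PropositionalEquality
  using (_≡_; _≢_; refl; sym; trans; cong; subst; module ≡-Reasoning)
open import Relation.Binary.Construct.Closure.ReflexiveTransitive using (Star; ε; _◅_)

x∈p─q⁺ : ∀ {N} {x : Fin N} p q → x ∈ p → x ∉ q → x ∈ p ─ q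
x∈p─q⁺ (_ ∷ p) (outside ∷ q) here       x∉q = here
x∈p─q⁺ (_ ∷ p) (inside ∷ q)  here       x∉q = ⊥-elim (x∉q here)
x∈p─q⁺ (_ ∷ p) (_ ∷ q)       (there x∈p) x∉q = there (x∈p─q⁺ p q x∈p (x∉q ∘ there))

x∈p─q⁻ : ∀ {N} {x : Fin N} p q → x ∈ p ─ q → x ∈ p × x ∉ q
x∈p─q⁻ (_ ∷ p) (outside ∷ q) here = here , λ ()
x∈p─q⁻ (_ ∷ p) (_ ∷ q) (there x∈p─q) with x∈p─q⁻ p q x∈p─q
... | x∈p , x∉q = there x∈p , λ { (there x∈q) → x∉q x∈q }

p─q⊆p─r : ∀ {N} (p q r : Subset N) → (∀ {x} → x ∈ p → x ∈ r → x ∈ q) → p ─ q ⊆ p ─ r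
p─q⊆p─r p q r r∩p⊆q x∈p─q with x∈p─q⁻ p q x∈p─q
... | x∈p , x∉q = x∈p─q⁺ p r x∈p (x∉q ∘ r∩p⊆q x∈p)

module BuildComponent (n m k p q T : ℕ) (E : Fin m → Subset n) (c0 : Fin n → Bool) where
  open Alg n m k p q T E c0

  BigTail-mono : ∀ {X Y : Subset n} → X ⊆ Y → BigTail ∣ X ∣ → BigTail ∣ Y ∣
  BigTail-mono X⊆Y big = ≤-trans big (*-monoˡ-≤ q (p⊆q⇒∣p∣≤∣q∣ X⊆Y))

  ∈ofColor : ∀ x → x ∈ ofColor (c0 x)
  ∈ofColor x = Vec.lookup⇒[]= x _
    (trans (Vec.lookup∘tabulate _ x) (dec-true (c0 x Bool.≟ c0 x) refl))

  Mono⇒⊆ofColor : ∀ X → Mono c0 X → ∃ λ b → X ⊆ ofColor b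
  Mono⇒⊆ofColor X mono with nonempty? X
  ... | yes (y , y∈X) = c0 y , λ {x} x∈X → subst (λ b → x ∈ ofColor b) (mono x y x∈X y∈X) (∈ofColor x)
  ... | no  X≡∅       = true , λ {x} x∈X → ⊥-elim (X≡∅ (x , x∈X))

  ∈⋃E⁺ : ∀ {x h} L → h List.∈ L → x ∈ E h → x ∈ ⋃E L
  ∈⋃E⁺ (h ∷ L) (here refl) x∈h = x∈p∪q⁺ (inj₁ x∈h)
  ∈⋃E⁺ (_ ∷ L) (there h∈L) x∈h = x∈p∪q⁺ (inj₂ (∈⋃E⁺ L h∈L x∈h))

  ∈⋃E⁻ : ∀ {x} L → x ∈ ⋃E L → ∃ λ h → h List.∈ L × x ∈ E h
  ∈⋃E⁻ []      x∈⊥ = ⊥-elim (∉⊥ x∈⊥)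
  ∈⋃E⁻ (h ∷ L) x∈⋃ with x∈p∪q⁻ (E h) (⋃E L) x∈⋃
  ... | inj₁ x∈h = h , here refl , x∈h
  ... | inj₂ x∈L with ∈⋃E⁻ L x∈L
  ...   | h′ , h′∈L , x∈h′ = h′ , there h′∈L , x∈h′

  ⋃E-++ : ∀ xs ys → ⋃E (xs ++ ys) ≡ ⋃E xs ∪ ⋃E ys
  ⋃E-++ []       ys = sym (∪-identityˡ (⋃E ys))
  ⋃E-++ (h ∷ xs) ys = trans (cong (E h ∪_) (⋃E-++ xs ys)) (sym (∪-assoc (E h) (⋃E xs) (⋃E ys)))

  ⋃E-∷ʳ : ∀ xs f → ⋃E (xs ++ f ∷ []) ≡ ⋃E xs ∪ E f
  ⋃E-∷ʳ xs f = trans (⋃E-++ xs (f ∷ [])) (cong (⋃E xs ∪_) (∪-identityʳ (E f)))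

  Cond2-++ : ∀ U xs ys → Cond2 U xs → Cond2 (U ∪ ⋃E xs) ys → Cond2 U (xs ++ ys)
  Cond2-++ U []       ys tt       c = subst (λ W → Cond2 W ys) (∪-identityʳ U) c
  Cond2-++ U (h ∷ xs) ys (b , cs) c =
    b , Cond2-++ (U ∪ E h) xs ys cs (subst (λ W → Cond2 W ys) (sym (∪-assoc U (E h) (⋃E xs))) c)

  chain-++ : ∀ xs ys → Cond2 ⊥ xs → Cond2 (⋃E xs) ys → Cond2 ⊥ (xs ++ ys)
  chain-++ xs ys cxs cys = Cond2-++ ⊥ xs ys cxs (subst (λ W → Cond2 W ys) (sym (∪-identityˡ (⋃E xs))) cys)

  Cond2-⊑ : ∀ {U U′ L′ L} → L′ ⊑ L → (∀ {x} → x ∈ ⋃E L′ → x ∈ U′ → x ∈ U) →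
            Cond2 U L → Cond2 U′ L′
  Cond2-⊑ []ˢ         _    tt      = tt
  Cond2-⊑ (h ∷ʳ L′⊑L) U′⊆U (_ , c) = Cond2-⊑ L′⊑L (λ x∈L′ → x∈p∪q⁺ ∘ inj₁ ∘ U′⊆U x∈L′) c
  Cond2-⊑ {U} {U′} {h ∷ L′} (refl ∷ˢ L′⊑L) U′⊆U ((b , big) , c) =
    (b , BigTail-mono shrink big) , Cond2-⊑ L′⊑L step c
    where
    shrink : ofColor b ∩ (E h ─ U) ⊆ ofColor b ∩ (E h ─ U′)
    shrink x∈ with x∈p∩q⁻ (ofColor b) (E h ─ U) x∈
    ... | x∈b , x∈h─U =
      x∈p∩q⁺ (x∈b , p─q⊆p─r (E h) U U′ (U′⊆U ∘ x∈p∪q⁺ ∘ inj₁) x∈h─U)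
    step : ∀ {x} → x ∈ ⋃E L′ → x ∈ U′ ∪ E h → x ∈ U ∪ E h
    step x∈L′ x∈U′∪h with x∈p∪q⁻ U′ (E h) x∈U′∪h
    ... | inj₁ x∈U′ = x∈p∪q⁺ (inj₁ (U′⊆U (x∈p∪q⁺ (inj₂ x∈L′)) x∈U′))
    ... | inj₂ x∈h  = x∈p∪q⁺ (inj₂ x∈h)

  MonoTail⇒Cond2 : ∀ {U X} f → MonoTail X f → (∀ {x} → x ∈ E f → x ∈ U → x ∈ X) →
                   Cond2 U (f ∷ [])
  MonoTail⇒Cond2 {U} {X} f (mono , big) U⊆X with Mono⇒⊆ofColor (E f ─ X) mono
  ... | b , f─X⊆b = (b , BigTail-mono tail⊆ big) , tt
    where
    tail⊆ : E f ─ X ⊆ ofColor b ∩ (E f ─ U)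
    tail⊆ x∈ = x∈p∩q⁺ (f─X⊆b x∈ , p─q⊆p─r (E f) X U U⊆X x∈)

  InN? : ∀ f → Decidable (InN f)
  InN? f h = ¬? (h Fin.≟ f) ×-dec nonempty? (E h ∩ E f)

  neighbours : Fin m → List (Fin m) → List (Fin m)
  neighbours f = filter (InN? f)

  ⋃E-neighbours⊆ : ∀ f L → ⋃E (neighbours f L) ⊆ ⋃E L
  ⋃E-neighbours⊆ f L x∈ with ∈⋃E⁻ (neighbours f L) x∈
  ... | h , h∈ , x∈h = ∈⋃E⁺ L (proj₁ (∈-filter⁻ (InN? f) h∈)) x∈h

  ─⋃E-neighbours : ∀ {u} f L → u ∈ E f → u ∉ ⋃E L →
                   E f ─ ⋃E (neighbours f L) ≡ E f ─ ⋃E L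
  ─⋃E-neighbours {u} f L u∈f u∉L = ⊆-antisym
    (p─q⊆p─r (E f) _ _ λ x∈f x∈L → neighbour x∈f (∈⋃E⁻ L x∈L))
    (p─q⊆p─r (E f) _ _ λ _ → ⋃E-neighbours⊆ f L)
    where
    neighbour : ∀ {x} → x ∈ E f → (∃ λ h → h List.∈ L × x ∈ E h) → x ∈ ⋃E (neighbours f L)
    neighbour {x} x∈f (h , h∈L , x∈h) =
      ∈⋃E⁺ (neighbours f L) (∈-filter⁺ (InN? f) h∈L (h≢f , x , x∈p∩q⁺ (x∈h , x∈f))) x∈h
      where
      h≢f : h ≢ f
      h≢f refl = u∉L (∈⋃E⁺ L h∈L u∈f)

  neighbourStructure : ∀ {u} f L → Cond2 ⊥ L → MonoTail (⋃E L) f → u ∈ E f → u ∉ ⋃E L →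
                       ∃ λ S → u ∈ V S × V S ⊆ ⋃E L ∪ E f
  neighbourStructure f L chain tail u∈f u∉L =
    struct f hs (all-filter (InN? f) L , mono , big , Cond2-⊑ (filter-⊆ (InN? f) L) (λ _ x → x) chain)
    , x∈p∪q⁺ (inj₁ u∈f) , V⊆
    where
    hs : List (Fin m)
    hs = neighbours f L
    tail′ : MonoTail (⋃E hs) f
    tail′ = subst (λ X → Mono c0 X × BigTail ∣ X ∣) (sym (─⋃E-neighbours f L u∈f u∉L)) tail
    mono : Mono c0 (E f ─ ⋃E hs)
    mono = proj₁ tail′
    big : BigTail ∣ E f ─ ⋃E hs ∣
    big = proj₂ tail′
    V⊆ : E f ∪ ⋃E hs ⊆ ⋃E L ∪ E f
    V⊆ x∈ with x∈p∪q⁻ (E f) (⋃E hs) x∈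
    ... | inj₁ x∈f  = x∈p∪q⁺ (inj₂ x∈f)
    ... | inj₂ x∈hs = x∈p∪q⁺ (inj₁ (⋃E-neighbours⊆ f L x∈hs))

  Covered : Subset n → Set
  Covered C = ∀ u → u ∈ C → ∃ λ S → u ∈ V S × V S ⊆ C

  Covered-∪ : ∀ {C D} → Covered C → (∀ u → u ∈ D → u ∉ C → ∃ λ S → u ∈ V S × V S ⊆ C ∪ D) →
              Covered (C ∪ D)
  Covered-∪ {C} {D} covC covD u u∈C∪D with u ∈? C
  ... | yes u∈C with covC u u∈C
  ...   | S , u∈S , S⊆C = S , u∈S , x∈p∪q⁺ ∘ inj₁ ∘ S⊆C
  Covered-∪ {C} {D} covC covD u u∈C∪D | no u∉C with x∈p∪q⁻ C D u∈C∪D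
  ...   | inj₁ u∈C = ⊥-elim (u∉C u∈C)
  ...   | inj₂ u∈D = covD u u∈D u∉C

  record Decomposition (C : Subset n) : Set where
    field
      edges   : List (Fin m)
      chain   : Cond2 ⊥ edges
      ⋃edges  : ⋃E edges ≡ C
      covered : Covered C

  decomposition-⊥ : Decomposition ⊥
  decomposition-⊥ =
    record { edges = [] ; chain = tt ; ⋃edges = refl ; covered = λ _ → ⊥-elim ∘ ∉⊥ }

  decomposition-∪V : ∀ {C} S → Decomposition C → Empty (V S ∩ C) → Decomposition (C ∪ V S)
  decomposition-∪V (struct f hs (nbrs , mono , big , chainₛ))
                   record { edges = L ; chain = chain ; ⋃edges = refl ; covered = cov } S∩C≡∅ =
    record
      { edges   = L ++ hs ++ f ∷ []
      ; chain   = chain-++ L (hs ++ f ∷ []) chain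
                    (Cond2-++ (⋃E L) hs (f ∷ []) (Cond2-⊑ ⊆-refl hs∩L≡∅ chainₛ)
                      (MonoTail⇒Cond2 f (mono , big) f∩L⊆hs))
      ; ⋃edges  = ⋃edges≡
      ; covered = Covered-∪ cov λ u u∈S _ → S , u∈S , q⊆p∪q (⋃E L) (V S)
      }
    where
    S : Struct
    S = struct f hs (nbrs , mono , big , chainₛ)
    outside-L : ∀ {x} → x ∈ V S → x ∉ ⋃E L
    outside-L x∈S x∈L = S∩C≡∅ (_ , x∈p∩q⁺ (x∈S , x∈L))
    hs∩L≡∅ : ∀ {x} → x ∈ ⋃E hs → x ∈ ⋃E L → x ∈ ⊥
    hs∩L≡∅ x∈hs = ⊥-elim ∘ outside-L (x∈p∪q⁺ (inj₂ x∈hs))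
    f∩L⊆hs : ∀ {x} → x ∈ E f → x ∈ ⋃E L ∪ ⋃E hs → x ∈ ⋃E hs
    f∩L⊆hs x∈f x∈L∪hs with x∈p∪q⁻ (⋃E L) (⋃E hs) x∈L∪hs
    ... | inj₁ x∈L  = ⊥-elim (outside-L (x∈p∪q⁺ (inj₁ x∈f)) x∈L)
    ... | inj₂ x∈hs = x∈hs
    ⋃edges≡ : ⋃E (L ++ hs ++ f ∷ []) ≡ ⋃E L ∪ V S
    ⋃edges≡ = begin
      ⋃E (L ++ hs ++ f ∷ [])    ≡⟨ ⋃E-++ L (hs ++ f ∷ []) ⟩
      ⋃E L ∪ ⋃E (hs ++ f ∷ [])  ≡⟨ cong (⋃E L ∪_) (⋃E-∷ʳ hs f) ⟩
      ⋃E L ∪ (⋃E hs ∪ E f)      ≡⟨ cong (⋃E L ∪_) (∪-comm (⋃E hs) (E f)) ⟩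
      ⋃E L ∪ V S                ∎
      where open ≡-Reasoning

  decomposition-∪tail : ∀ {C} f → Decomposition C → MonoTail C f → Decomposition (C ∪ E f)
  decomposition-∪tail f record { edges = L ; chain = chain ; ⋃edges = refl ; covered = cov } tail =
    record
      { edges   = L ++ f ∷ []
      ; chain   = chain-++ L (f ∷ []) chain (MonoTail⇒Cond2 f tail λ _ x∈L → x∈L)
      ; ⋃edges  = ⋃E-∷ʳ L f
      ; covered = Covered-∪ cov λ u → neighbourStructure f L chain tail
      }

  decomposition-V : ∀ S → Decomposition (V S)
  decomposition-V S = subst Decomposition (∪-identityˡ (V S))
    (decomposition-∪V S decomposition-⊥ λ (_ , x∈S∩⊥) → ∉⊥ (proj₂ (x∈p∩q⁻ (V S) ⊥ x∈S∩⊥)))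

  decomposition-step : ∀ {comps C D} → Decomposition C → BuildStep comps C D → Decomposition D
  decomposition-step dec (BuildStep.addTail _ f tail)               = decomposition-∪tail f dec tail
  decomposition-step dec (BuildStep.addStruct _ _ S _ (S∩C≡∅ , _)) = decomposition-∪V S dec S∩C≡∅

  decomposition-star : ∀ {comps C D} → Decomposition C → Star (BuildStep comps) C D → Decomposition D
  decomposition-star dec ε            = dec
  decomposition-star dec (step ◅ run) = decomposition-star (decomposition-step dec step) run

proposition1 : (n m k p q T : ℕ) → 0 < p → p < q →
    (E : Fin m → Subset n) → (∀ i → ∣ E i ∣ ≡ k) →
    (∀ i j → E i ≡ E j → i ≡ j) →
    (c0 : Fin n → Bool) →
    let open Alg n m k p q T E c0 in
    (st : State) → Reachable st →
    (v : Fin n) → v ∉ colored st →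
    (S : Struct) → Fresh (comps st) S → v ∈ V S →
    (C : Subset n) → BuildReach (comps st) S C →
    ∀ u → u ∈ C → ∃ λ S' → u ∈ V S' × V S' ⊆ C
proposition1 n m k p q T _ _ E _ _ c0 _ _ _ _ S _ _ _ reach =
  Decomposition.covered (decomposition-star (decomposition-V S) reach)
  where open BuildComponent n m k p q T E c0
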